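{- For every atomic system $S$ and every formula of the form $A^c$ where $A$ is not atomic (i.e. $A^c=(B\circ C)^c$ for some connective $\circ\in\{\wedge,\vee,\to\}$ and $A^i=(B\circ C)^i$), $A^i\Vdash^L_S A^c$.
   Context: Basic setting. Let $\mathsf{At}$ be a countably infinite set of atomic propositions and $\mathsf{At}_\bot=\mathsf{At}\cup\{\bot\}$. An atomic rule has the form "from premises $p_1,\dots,p_n$ ($n\ge 0$) infer $p$", with $p_j,p\in\mathsf{At}_\bot$, where the derivation of each premise may discharge a set of basic sentences. An atomic system $S$ is a set of atomic rules; $S\subseteq S'$ ($S'$ extends $S$) if $S'$ contains all rules of $S$. $\Delta\vdash_S p$ means there is a natural-deduction derivation using only rules of $S$ with conclusion $p$ and undischarged assumptions in $\Delta$ (so $p\vdash_S p$). $S$ is consistent if $\nvdash_S\bot$. Standing convention: all atomic systems (including all extensions quantified over) are required to be consistent. Ecumenical formulas: $p^i,p^c$ for $p\in\mathsf{At}_\bot$; $(A\wedge B)^x,(A\vee B)^x,(A\to B)^x$ for $x\in\{i,c\}$. $A\wedge B$, $A\vee B$, $A\to B$ abbreviate the $i$-versions, $\bot$ denotes $\bot^i$, $\neg A:=(A\to\bot^i)^i$; for $X^c$, $X^i$ is the same construction with outer superscript $i$. Weak validity (by simultaneous recursion): (1) $\Vdash^L_S p^i$ iff $\vdash_S p$ ($p\in\mathsf{At}_\bot$); (2) $\Vdash^L_S p^c$ iff $p\nvdash_S\bot$; (3) for non-atomic $X$, $\Vdash^L_S X^c$ iff $X^i\nVdash^L_S\bot$;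 (4) $\Vdash^L_S(A\wedge B)^i$ iff $\Vdash^L_S A$ and $\Vdash^L_S B$; (5) $\Vdash^L_S(A\to B)^i$ iff $A\Vdash^G_S B$; (6) $\Vdash^L_S(A\vee B)^i$ iff for all $S'\supseteq S$ and all $p\in\mathsf{At}_\bot$, if $A\Vdash^L_{S'}p^i$ and $B\Vdash^L_{S'}p^i$ then $\Vdash^L_{S'}p^i$; (7) for nonempty $\Gamma$, $\Gamma\Vdash^L_S A$ iff for all $S'\supseteq S$, if $\Vdash^L_{S'}B$ for all $B\in\Gamma$ then $\Vdash^L_{S'}A$; (8) $\Gamma\Vdash^G_S A$ iff for all $S'\supseteq S$: if $\Vdash^L_{S''}B$ for all $B\in\Gamma$ and all $S''\supseteq S'$, then $\Vdash^L_{S''}A$ for all $S''\supseteq S'$; (9) $\Gamma\Vdash A$ iff $\Gamma\Vdash^G_S A$ for all $S$. -}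

module Defs where

open import Data.Nat using (ℕ)
open import Data.List using (List; []; _∷_; _++_)
open import Data.List.Membership.Propositional using (_∈_)
open import Data.List.Relation.Unary.All using (All)
open import Data.Product using (_×_; _,_; proj₁; proj₂)
open import Relation.Nullary using (¬_)
open import Level using (Lift; suc; zero)

data Atom : Set where
  at  : ℕ → Atom
  bot : Atom

-- An atomic rule: premises p_1..p_n, each with the (finite) set of
-- basic sentences its derivation may discharge, and a conclusion p.
record Rule : Set where
  constructor mkRule
  field
    premises : List (List Atom × Atom)
    concl    : Atom
open Rule public

System : Set₁
System = Rule → Set

_⊑_ : System → System → Set
S ⊑ S' = ∀ r → S r → S' r

data Deriv (S : System) : List Atom → Atom → Set where
  ax   : ∀ {Δ p} → p ∈ Δ → Deriv S Δ p
  rule : ∀ {Δ} (r : Rule) → S r →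
         All (λ pr → Deriv S (proj₁ pr ++ Δ) (proj₂ pr)) (premises r) →
         Deriv S Δ (concl r)

_⊢[_]_ : List Atom → System → Atom → Set
Δ ⊢[ S ] p = Deriv S Δ p

Consistent : System → Set
Consistent S = ¬ ([] ⊢[ S ] bot)

data Kind : Set where
  i c : Kind

data Conn : Set where
  ∧′ ∨′ →′ : Conn

data Formula : Set where
  atm : Kind → Atom → Formula
  bin : Conn → Kind → Formula → Formula → Formula

⊥ⁱ : Formula
⊥ⁱ = atm i bot

-- Weak validity.  ⊩L S A  is  ⊩^L_S A ; all systems (also extensions
-- quantified over) are required to be consistent.
-- VBin o S A B  is  ⊩^L_S (A ∘ B)^i.
mutual
  ⊩L : System → Formula → Set₁
  ⊩L S (atm i p) = Lift (suc zero) ([] ⊢[ S ] p)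
  ⊩L S (atm c p) = Lift (suc zero) (¬ ((p ∷ []) ⊢[ S ] bot))
  ⊩L S (bin o i A B) = VBin o S A B
  -- (3): X^i ⊮^L_S ⊥, with X^i ⊩^L_S ⊥ given by clause (7)
  ⊩L S (bin o c A B) =
    ¬ (∀ (S' : System) → S ⊑ S' → Consistent S' →
         VBin o S' A B → ⊩L S' ⊥ⁱ)

  VBin : Conn → System → Formula → Formula → Set₁
  VBin ∧′ S A B = ⊩L S A × ⊩L S B
  -- (5) with (8): A ⊩^G_S B
  VBin →′ S A B =
    ∀ (S' : System) → S ⊑ S' → Consistent S' →
      (∀ (S'' : System) → S' ⊑ S'' → Consistent S'' → ⊩L S'' A) →
      (∀ (S'' : System) → S' ⊑ S'' → Consistent S'' → ⊩L S'' B)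
  -- (6) with (7) for A ⊩^L_{S'} p^i and B ⊩^L_{S'} p^i
  VBin ∨′ S A B =
    ∀ (S' : System) → S ⊑ S' → Consistent S' → ∀ (p : Atom) →
      (∀ (S'' : System) → S' ⊑ S'' → Consistent S'' → ⊩L S'' A → [] ⊢[ S'' ] p) →
      (∀ (S'' : System) → S' ⊑ S'' → Consistent S'' → ⊩L S'' B → [] ⊢[ S'' ] p) →
      [] ⊢[ S' ] p

-- (7) for a single premise: A ⊩^L_S B
_⊩L[_]_ : Formula → System → Formula → Set₁
A ⊩L[ S ] B = ∀ (S' : System) → S ⊑ S' → Consistent S' → ⊩L S' A → ⊩L S' B

module Submission where

open import Defs
open import Level using (lift)
open import Relation.Nullary using (¬_)

⊑-refl : ∀ {S} → S ⊑ S
⊑-refl _ r∈S = r∈S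

consistent⇒⊮⊥ : ∀ {S} → Consistent S → ¬ ⊩L S ⊥ⁱ
consistent⇒⊮⊥ consistent (lift ⊢⊥) = consistent ⊢⊥

theorem2 : (S : System) → Consistent S → (o : Conn) → (B C : Formula) →
    bin o i B C ⊩L[ S ] bin o c B C
theorem2 _ _ _ _ _ S' _ consistent′ valid entails⊥ =
  consistent⇒⊮⊥ consistent′ (entails⊥ S' ⊑-refl consistent′ valid)
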